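{- Let $\overline{P_n}$ be the complement of the path $P_n$ of order $n\geq 4$. Then $\overline{P_n}$ belongs to Class 1.
   Context: A total dominator coloring (TDC) of a graph $G$ is a proper coloring in which every vertex is adjacent to every vertex of some color class; $\chi_d^t(G)$ is the minimum number of color classes in a TDC, and a $\chi_d^t$-coloring is a TDC with $\chi_d^t(G)$ colors. For a TDC $f=(V_1,\dots,V_\ell)$ with color classes $V_i$, $v\succ V_i$ means $v$ is adjacent to all vertices of $V_i$; $pn_G(V_i;f)$ is the set of vertices $v$ with $v\succ V_i$ and $v\not\succ V_j$ for all $j\ne i$. $G$ is in Class 1 if some $\chi_d^t$-coloring $f$ has $pn_G(V_i;f)=\emptyset$ for some $i$, and in Class 2 otherwise. -}

module Defs where

open import Data.Nat using (ℕ; suc; _≤_)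
open import Data.Fin using (Fin; toℕ)
open import Data.Product using (Σ; ∃; _×_; _,_)
open import Data.Sum using (_⊎_)
open import Relation.Nullary using (¬_)
open import Relation.Binary.PropositionalEquality using (_≡_; _≢_)

Graph : ℕ → Set₁
Graph n = Fin n → Fin n → Set

PathAdj : (n : ℕ) → Graph n
PathAdj n i j = (suc (toℕ i) ≡ toℕ j) ⊎ (suc (toℕ j) ≡ toℕ i)

Complement : {n : ℕ} → Graph n → Graph n
Complement G i j = (i ≢ j) × ¬ G i j

CoPath : (n : ℕ) → Graph n
CoPath n = Complement (PathAdj n)

-- A coloring with exactly ℓ color classes V_0,...,V_{ℓ-1}:
-- a map c : vertices → Fin ℓ with every class nonempty (surjective).
Surjective : {n ℓ : ℕ} → (Fin n → Fin ℓ) → Set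
Surjective {n} {ℓ} c = (i : Fin ℓ) → ∃ λ (v : Fin n) → c v ≡ i

Proper : {n ℓ : ℕ} → Graph n → (Fin n → Fin ℓ) → Set
Proper G c = ∀ u v → G u v → c u ≢ c v

Dominates : {n ℓ : ℕ} → Graph n → (Fin n → Fin ℓ) → Fin n → Fin ℓ → Set
Dominates G c v i = ∀ u → c u ≡ i → G v u

-- Total dominator coloring with ℓ (nonempty) color classes.
record IsTDC {n ℓ : ℕ} (G : Graph n) (c : Fin n → Fin ℓ) : Set where
  field
    surjective : Surjective c
    proper     : Proper G c
    dominating : ∀ v → ∃ λ (i : Fin ℓ) → Dominates G c v i

HasTDC : {n : ℕ} → Graph n → ℕ → Set
HasTDC {n} G ℓ = ∃ λ (c : Fin n → Fin ℓ) → IsTDC G c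

IsTDChromatic : {n : ℕ} → Graph n → ℕ → Set
IsTDChromatic G ℓ = HasTDC G ℓ × (∀ m → HasTDC G m → ℓ ≤ m)

-- pn_G(V_i; c) = ∅ : every vertex dominating V_i also dominates some other V_j.
EmptyPN : {n ℓ : ℕ} → Graph n → (Fin n → Fin ℓ) → Fin ℓ → Set
EmptyPN G c i = ∀ v → Dominates G c v i → ∃ λ j → (j ≢ i) × Dominates G c v j

Class1 : {n : ℕ} → Graph n → Set
Class1 {n} G = ∃ λ (ℓ : ℕ) → IsTDChromatic G ℓ ×
  ∃ λ (c : Fin n → Fin ℓ) → IsTDC G c × ∃ λ (i : Fin ℓ) → EmptyPN G c i

-- A proper colouring of the complement of P_n has colour classes that are cliques of P_n,
-- i.e. single vertices or edges {i, i+1}, so at least ⌈n/2⌉ colours are needed; since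
-- colour and parity together determine a vertex, this is an injection into Fin m × Fin 2.
-- For n ≥ 5 the pairing {0,1}, {2,3}, {4,5}, … attains the bound, and for n = 4 the colouring
-- {0}, {1,2}, {3} is optimal because a 2-colouring fails at vertex 1, whose non-neighbours
-- 0 and 2 are adjacent. In both colourings every vertex sees all of the first class or all
-- of the third, so the second class {2,3} (resp. {1,2}) has no private neighbour.
module Submission where

open import Defs
open import Data.Nat using (ℕ; zero; suc; _+_; _*_; _≤_; _<_; _≥_; z≤n; s≤s; ⌊_/2⌋; ⌈_/2⌉)
open import Data.Nat.Properties
  using (≤-trans; ≤-reflexive; n≤1+n; 1+n≰n; +-suc; suc-injective; _≤?_; ≰⇒>; ⌊n/2⌋-mono; n≡⌊n+n/2⌋)
open import Data.Fin using (Fin; toℕ; fromℕ<; combine; _≟_)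
open import Data.Fin.Patterns using (0F; 1F; 2F; 3F)
open import Data.Fin.Properties using (toℕ-injective; toℕ-fromℕ<; toℕ<n; injective⇒≤; combine-injective)
open import Data.Product using (_,_)
open import Data.Sum using (_⊎_; inj₁; inj₂; [_,_]′)
open import Data.Empty using (⊥-elim)
open import Relation.Nullary using (¬_; yes; no)
open import Relation.Binary.PropositionalEquality using (_≡_; _≢_; refl; sym; cong)
open Relation.Binary.PropositionalEquality.≡-Reasoning

private
  variable
    n ℓ : ℕ

Near : ℕ → ℕ → Set
Near a b = a ≡ b ⊎ (suc a ≡ b ⊎ suc b ≡ a)

Near-sym : ∀ {a b} → Near a b → Near b a
Near-sym (inj₁ e)        = inj₁ (sym e)
Near-sym (inj₂ (inj₁ e)) = inj₂ (inj₂ e)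
Near-sym (inj₂ (inj₂ e)) = inj₂ (inj₁ e)

Near-suc⁻¹ : ∀ {a b} → Near (suc a) (suc b) → Near a b
Near-suc⁻¹ (inj₁ e)        = inj₁ (suc-injective e)
Near-suc⁻¹ (inj₂ (inj₁ e)) = inj₂ (inj₁ (suc-injective e))
Near-suc⁻¹ (inj₂ (inj₂ e)) = inj₂ (inj₂ (suc-injective e))

Near-suc : ∀ {a b} → Near a b → Near (suc a) (suc b)
Near-suc (inj₁ e)        = inj₁ (cong suc e)
Near-suc (inj₂ (inj₁ e)) = inj₂ (inj₁ (cong suc e))
Near-suc (inj₂ (inj₂ e)) = inj₂ (inj₂ (cong suc e))

Near-+-cancelˡ : ∀ s {a b} → Near (s + a) (s + b) → Near a b
Near-+-cancelˡ zero    p = p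
Near-+-cancelˡ (suc s) p = Near-+-cancelˡ s (Near-suc⁻¹ p)

gap⇒¬Near : ∀ {a b} → 2 + a ≤ b → ¬ Near a b
gap⇒¬Near h (inj₁ refl)        = 1+n≰n (≤-trans (n≤1+n _) h)
gap⇒¬Near h (inj₂ (inj₁ refl)) = 1+n≰n h
gap⇒¬Near h (inj₂ (inj₂ refl)) = 1+n≰n (≤-trans (n≤1+n _) (≤-trans (n≤1+n _) h))

gap-+-cancelˡ : ∀ s {a b} → 2 + (s + a) ≤ s + b → 2 + a ≤ b
gap-+-cancelˡ zero    h       = h
gap-+-cancelˡ (suc s) (s≤s h) = gap-+-cancelˡ s h

⌊n/2⌋-≡⇒Near : ∀ a b → ⌊ a /2⌋ ≡ ⌊ b /2⌋ → Near a b
⌊n/2⌋-≡⇒Near 0 0 _ = inj₁ refl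
⌊n/2⌋-≡⇒Near 0 1 _ = inj₂ (inj₁ refl)
⌊n/2⌋-≡⇒Near 1 0 _ = inj₂ (inj₂ refl)
⌊n/2⌋-≡⇒Near 1 1 _ = inj₁ refl
⌊n/2⌋-≡⇒Near 0 (suc (suc b)) ()
⌊n/2⌋-≡⇒Near 1 (suc (suc b)) ()
⌊n/2⌋-≡⇒Near (suc (suc a)) 0 ()
⌊n/2⌋-≡⇒Near (suc (suc a)) 1 ()
⌊n/2⌋-≡⇒Near (suc (suc a)) (suc (suc b)) e = Near-suc (Near-suc (⌊n/2⌋-≡⇒Near a b (suc-injective e)))

⌊n/2⌋-double≤ : ∀ a → ⌊ a /2⌋ + ⌊ a /2⌋ ≤ a
⌊n/2⌋-double≤ 0 = z≤n
⌊n/2⌋-double≤ 1 = z≤n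
⌊n/2⌋-double≤ (suc (suc a)) rewrite +-suc ⌊ a /2⌋ ⌊ a /2⌋ = s≤s (s≤s (⌊n/2⌋-double≤ a))

≤suc-⌊n/2⌋-double : ∀ a → a ≤ suc (⌊ a /2⌋ + ⌊ a /2⌋)
≤suc-⌊n/2⌋-double 0 = z≤n
≤suc-⌊n/2⌋-double 1 = s≤s z≤n
≤suc-⌊n/2⌋-double (suc (suc a)) rewrite +-suc ⌊ a /2⌋ ⌊ a /2⌋ = s≤s (s≤s (≤suc-⌊n/2⌋-double a))

⌈m*2/2⌉≡m : ∀ m → ⌈ m * 2 /2⌉ ≡ m
⌈m*2/2⌉≡m zero    = refl
⌈m*2/2⌉≡m (suc m) = cong suc (⌈m*2/2⌉≡m m)

<⌈n/2⌉⇒+< : ∀ i n → i < ⌈ n /2⌉ → i + i < n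
<⌈n/2⌉⇒+< zero    (suc n)       _       = s≤s z≤n
<⌈n/2⌉⇒+< (suc i) (suc (suc n)) (s≤s h) rewrite +-suc i i = s≤s (s≤s (<⌈n/2⌉⇒+< i n h))
<⌈n/2⌉⇒+< (suc i) 1             (s≤s ())

Near⇒¬CoPath : ∀ {u v : Fin n} → Near (toℕ u) (toℕ v) → ¬ CoPath n u v
Near⇒¬CoPath (inj₁ e) (u≢v , _)  = u≢v (toℕ-injective e)
Near⇒¬CoPath (inj₂ p) (_ , ¬adj) = ¬adj p

¬Near⇒CoPath : ∀ {u v : Fin n} → ¬ Near (toℕ u) (toℕ v) → CoPath n u v
¬Near⇒CoPath ¬near = (λ u≡v → ¬near (inj₁ (cong toℕ u≡v))) , (λ adj → ¬near (inj₂ adj))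

coPath-gap : ∀ {u v : Fin n} → 2 + toℕ u ≤ toℕ v → CoPath n u v
coPath-gap h = ¬Near⇒CoPath (gap⇒¬Near h)

coPath-gap′ : ∀ {u v : Fin n} → 2 + toℕ v ≤ toℕ u → CoPath n u v
coPath-gap′ h = ¬Near⇒CoPath (λ near → gap⇒¬Near h (Near-sym near))

parity : ℕ → Fin 2
parity 0             = 0F
parity 1             = 1F
parity (suc (suc a)) = parity a

parity-suc : ∀ a → parity (suc a) ≢ parity a
parity-suc 0             ()
parity-suc 1             ()
parity-suc (suc (suc a)) = parity-suc a

Near∧sameParity⇒≡ : ∀ {a b} → Near a b → parity a ≡ parity b → a ≡ b
Near∧sameParity⇒≡         (inj₁ e)           _ = e
Near∧sameParity⇒≡ {a = a} (inj₂ (inj₁ refl)) p = ⊥-elim (parity-suc a (sym p))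
Near∧sameParity⇒≡ {b = b} (inj₂ (inj₂ refl)) p = ⊥-elim (parity-suc b p)

coPath-proper⇒≤*2 : (c : Fin n → Fin ℓ) → Proper (CoPath n) c → n ≤ ℓ * 2
coPath-proper⇒≤*2 c proper = injective⇒≤ colour×parity-injective
  where
  colour×parity-injective : ∀ {u v} → combine (c u) (parity (toℕ u)) ≡ combine (c v) (parity (toℕ v)) → u ≡ v
  colour×parity-injective {u} {v} e with combine-injective (c u) _ (c v) _ e | u ≟ v
  ... | _             | yes u≡v = u≡v
  ... | c≡c , par≡par | no u≢v  =
    ⊥-elim (proper u v (u≢v , λ adj → u≢v (toℕ-injective (Near∧sameParity⇒≡ (inj₂ adj) par≡par))) c≡c)

coPath-proper⇒⌈n/2⌉≤ : (c : Fin n → Fin ℓ) → Proper (CoPath n) c → ⌈ n /2⌉ ≤ ℓ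
coPath-proper⇒⌈n/2⌉≤ {ℓ = ℓ} c proper =
  ≤-trans (⌊n/2⌋-mono (s≤s (coPath-proper⇒≤*2 c proper))) (≤-reflexive (⌈m*2/2⌉≡m ℓ))

-- The colouring v ↦ ⌊(s + v)/2⌋: classes are consecutive pairs, the first one a singleton if s is odd.
IsHalving : ℕ → (Fin n → Fin ℓ) → Set
IsHalving s c = ∀ v → toℕ (c v) ≡ ⌊ s + toℕ v /2⌋

halving-proper : ∀ s {c : Fin n → Fin ℓ} → IsHalving s c → Proper (CoPath n) c
halving-proper s {c} halving u v adj cu≡cv = Near⇒¬CoPath (Near-+-cancelˡ s sameHalf) adj
  where
  sameHalf : Near (s + toℕ u) (s + toℕ v)
  sameHalf = ⌊n/2⌋-≡⇒Near _ _ (begin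
    ⌊ s + toℕ u /2⌋ ≡⟨ sym (halving u) ⟩
    toℕ (c u)       ≡⟨ cong toℕ cu≡cv ⟩
    toℕ (c v)       ≡⟨ halving v ⟩
    ⌊ s + toℕ v /2⌋ ∎)

halving-class-lower : ∀ s {c : Fin n → Fin ℓ} → IsHalving s c →
  ∀ u → toℕ (c u) + toℕ (c u) ≤ s + toℕ u
halving-class-lower s halving u rewrite halving u = ⌊n/2⌋-double≤ (s + toℕ u)

halving-class-upper : ∀ s {c : Fin n → Fin ℓ} → IsHalving s c →
  ∀ u → s + toℕ u ≤ suc (toℕ (c u) + toℕ (c u))
halving-class-upper s halving u rewrite halving u = ≤suc-⌊n/2⌋-double (s + toℕ u)

halving-dominates-above : ∀ s {c : Fin n → Fin ℓ} → IsHalving s c →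
  ∀ v i → 2 + (s + toℕ v) ≤ toℕ i + toℕ i → Dominates (CoPath n) c v i
halving-dominates-above s halving v i h u refl =
  coPath-gap (gap-+-cancelˡ s (≤-trans h (halving-class-lower s halving u)))

halving-dominates-below : ∀ s {c : Fin n → Fin ℓ} → IsHalving s c →
  ∀ v i → 2 + suc (toℕ i + toℕ i) ≤ s + toℕ v → Dominates (CoPath n) c v i
halving-dominates-below s halving v i h u refl =
  coPath-gap′ (gap-+-cancelˡ s (≤-trans (s≤s (s≤s (halving-class-upper s halving u))) h))

halving-dominates-0F⊎2F : ∀ s {c : Fin n → Fin (3 + ℓ)} → IsHalving s c →
  ∀ v → Dominates (CoPath n) c v 0F ⊎ Dominates (CoPath n) c v 2F
halving-dominates-0F⊎2F s halving v with s + toℕ v ≤? 2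
... | yes low  = inj₂ (halving-dominates-above s halving v 2F (s≤s (s≤s low)))
... | no  ¬low = inj₁ (halving-dominates-below s halving v 0F (≰⇒> ¬low))

halving-isTDC : ∀ s {c : Fin n → Fin (3 + ℓ)} → IsHalving s c → Surjective c → IsTDC (CoPath n) c
halving-isTDC s halving surjective = record
  { surjective = surjective
  ; proper     = halving-proper s halving
  ; dominating = λ v → [ 0F ,_ , 2F ,_ ]′ (halving-dominates-0F⊎2F s halving v)
  }

halving-emptyPN : ∀ s {c : Fin n → Fin (3 + ℓ)} → IsHalving s c → EmptyPN (CoPath n) c 1F
halving-emptyPN s halving v _ = [ (λ d → 0F , (λ ()) , d) , (λ d → 2F , (λ ()) , d) ]′ (halving-dominates-0F⊎2F s halving v)

Class1-intro : ∀ {G : Graph n} {c : Fin n → Fin ℓ} → IsTDC G c → (∀ m → HasTDC G m → ℓ ≤ m) →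
  (i : Fin ℓ) → EmptyPN G c i → Class1 G
Class1-intro {ℓ = ℓ} {c = c} tdc minimal i emptyPN = ℓ , ((c , tdc) , minimal) , c , tdc , i , emptyPN

fin2-≢⇒≡ : (x y i : Fin 2) → x ≢ i → y ≢ i → x ≡ y
fin2-≢⇒≡ 0F 0F _  _   _   = refl
fin2-≢⇒≡ 1F 1F _  _   _   = refl
fin2-≢⇒≡ 0F 1F 0F x≢i _   = ⊥-elim (x≢i refl)
fin2-≢⇒≡ 0F 1F 1F _   y≢i = ⊥-elim (y≢i refl)
fin2-≢⇒≡ 1F 0F 0F _   y≢i = ⊥-elim (y≢i refl)
fin2-≢⇒≡ 1F 0F 1F x≢i _   = ⊥-elim (x≢i refl)

TDC₂-nonNeighbours-independent : ∀ {G : Graph n} {c : Fin n → Fin 2} → IsTDC G c →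
  ∀ v {a b} → ¬ G v a → ¬ G v b → ¬ G a b
TDC₂-nonNeighbours-independent {c = c} tdc v {a} {b} ¬va ¬vb ab
  with IsTDC.dominating tdc v
... | i , dominates =
  IsTDC.proper tdc a b ab (fin2-≢⇒≡ (c a) (c b) i (λ ca≡i → ¬va (dominates a ca≡i)) (λ cb≡i → ¬vb (dominates b cb≡i)))

pairing : Fin n → Fin ⌈ n /2⌉
pairing {n} v = fromℕ< (⌊n/2⌋-mono (s≤s (toℕ<n v)))

pairing-isHalving : IsHalving {n} 0 pairing
pairing-isHalving v = toℕ-fromℕ< _

pairing-surjective : Surjective (pairing {n})
pairing-surjective {n} i = v , toℕ-injective (begin
  toℕ (pairing v)     ≡⟨ pairing-isHalving v ⟩
  ⌊ toℕ v /2⌋         ≡⟨ cong ⌊_/2⌋ (toℕ-fromℕ< _) ⟩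
  ⌊ toℕ i + toℕ i /2⌋ ≡⟨ sym (n≡⌊n+n/2⌋ (toℕ i)) ⟩
  toℕ i               ∎)
  where
  v : Fin n
  v = fromℕ< (<⌈n/2⌉⇒+< (toℕ i) n (toℕ<n i))

coPath-class1-≥5 : ∀ k → Class1 (CoPath (5 + k))
coPath-class1-≥5 k =
  Class1-intro (halving-isTDC 0 pairing-isHalving pairing-surjective) minimal 1F (halving-emptyPN 0 pairing-isHalving)
  where
  minimal : ∀ m → HasTDC (CoPath (5 + k)) m → ⌈ 5 + k /2⌉ ≤ m
  minimal m (c , tdc) = coPath-proper⇒⌈n/2⌉≤ c (IsTDC.proper tdc)

colouring₄ : Fin 4 → Fin 3
colouring₄ 0F = 0F
colouring₄ 1F = 1F
colouring₄ 2F = 1F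
colouring₄ 3F = 2F

colouring₄-isHalving : IsHalving 1 colouring₄
colouring₄-isHalving 0F = refl
colouring₄-isHalving 1F = refl
colouring₄-isHalving 2F = refl
colouring₄-isHalving 3F = refl

colouring₄-surjective : Surjective colouring₄
colouring₄-surjective 0F = 0F , refl
colouring₄-surjective 1F = 1F , refl
colouring₄-surjective 2F = 3F , refl

coPath₄-no-TDC₂ : ¬ HasTDC (CoPath 4) 2
coPath₄-no-TDC₂ (_ , tdc) =
  TDC₂-nonNeighbours-independent tdc 1F (Near⇒¬CoPath (inj₂ (inj₂ refl))) (Near⇒¬CoPath (inj₂ (inj₁ refl)))
    (coPath-gap (s≤s (s≤s z≤n)))

coPath-class1-4 : Class1 (CoPath 4)
coPath-class1-4 = Class1-intro (halving-isTDC 1 colouring₄-isHalving colouring₄-surjective) minimal 1F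
  (halving-emptyPN 1 colouring₄-isHalving)
  where
  minimal : ∀ m → HasTDC (CoPath 4) m → 3 ≤ m
  minimal 2 has = ⊥-elim (coPath₄-no-TDC₂ has)
  minimal (suc (suc (suc _))) _ = s≤s (s≤s (s≤s z≤n))
  minimal 0 (c , tdc) with coPath-proper⇒⌈n/2⌉≤ c (IsTDC.proper tdc)
  ... | ()
  minimal 1 (c , tdc) with coPath-proper⇒⌈n/2⌉≤ c (IsTDC.proper tdc)
  ... | s≤s ()

proposition3p5 : (n : ℕ) → n ≥ 4 → Class1 (CoPath n)
proposition3p5 4                               _                     = coPath-class1-4
proposition3p5 (suc (suc (suc (suc (suc k))))) _                     = coPath-class1-≥5 k
proposition3p5 0                               ()
proposition3p5 1                               (s≤s ())
proposition3p5 2                               (s≤s (s≤s ()))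
proposition3p5 3                               (s≤s (s≤s (s≤s ())))
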